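{- Let $x^{\min}\in\mathbf L$ and suppose $(x^{\min},\mathbf{L}_{\rm top})$ is a strong LP-autarky for $\mathbf f$, where $\mathbf L_{\rm top}$ is the labeling with all components equal to $L$. Then for every $\mu^*\in\arg\min_{\mu\in\Lambda}\langle\mu,f\rangle$, every $s\in\mathcal V$ and every $i<x^{\min}_s$, we have $\mu^*_{s,i}=0$.
   Context: Let $\mathcal V$ be a finite set, $\mathcal E\subseteq\mathcal V\times\mathcal V$, $L\in\mathbb N$, $\mathcal L_s=\{0,\dots,L\}$ (natural order), $\mathbf L=\prod_s\mathcal L_s$, energy $\mathbf f(x)=f_0+\sum_sf_s(x_s)+\sum_{st\in\mathcal E}f_{st}(x_s,x_t)$. Write $f$ for the vector with components $f_0$, $f_{s,i}=f_s(i)$, $f_{st,ij}=f_{st}(i,j)$, and $\langle \mu,f\rangle=f_0\mu_0+\sum f_{s,i}\mu_{s,i}+\sum f_{st,ij}\mu_{st,ij}$. The local polytope $\Lambda$ is the set of $\mu$ with $\mu_0=1$, $\mu_{s,i}\ge0$, $\mu_{st,ij}\ge0$, $\sum_{ij}\mu_{st,ij}=1$, $\sum_j\mu_{st,ij}=\mu_{s,i}$, $\sum_i\mu_{st,ij}=\mu_{t,j}$ for all $st\in\mathcal E$. For $\mu\in\Lambda$, $y\in\mathbf L$: $(\mu\barwedge y)_0=\mu_0$, $(\mu\barwedge y)_{s,i}=\sum_{i':\min(i',y_s)=i}\mu_{s,i'}$, $(\mu\barwedge y)_{st,ij}=\sum_{(i',j'):\min(i',y_s)=i,\min(j',y_t)=j}\mu_{st,i'j'}$;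 $\mu\veebar y$ is defined identically with $\max$ instead of $\min$. A pair $(x^{\min},x^{\max})$ with $x^{\min}\le x^{\max}$ componentwise is a strong LP-autarky for $\mathbf f$ if $\langle f,(\mu\veebar x^{\min})\barwedge x^{\max}\rangle\le\langle f,\mu\rangle$ for all $\mu\in\Lambda$, with strict inequality for every $\mu\in\Lambda$ such that $(\mu\veebar x^{\min})\barwedge x^{\max}\ne\mu$.
   Formalization: The energy components of f and the points of the local polytope Λ, including every minimiser μ*, have rational entries. -}

module Defs where

open import Data.Nat using (ℕ; zero; suc)
open import Data.Fin using (Fin; zero; suc; fromℕ; _≤?_)
import Data.Empty
import Data.Fin
open import Data.Product using (_×_; _,_; proj₁; proj₂)
open import Data.Bool using (if_then_else_)
open import Relation.Nullary.Decidable using (⌊_⌋)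
open import Relation.Binary.PropositionalEquality using (_≡_)
open import Data.Rational using (ℚ; 0ℚ; 1ℚ; _+_; _*_; _≤_; _<_)

Σ[_] : (k : ℕ) → (Fin k → ℚ) → ℚ
Σ[ zero ] g = 0ℚ
Σ[ suc k ] g = g zero + Σ[ k ] (λ i → g (suc i))

-- A pairwise MRF: node set V = Fin n, edge set E given by an (injective)
-- enumeration edge : Fin m → Fin n × Fin n, label set 𝓛_s = Fin (suc L) = {0,…,L}.
-- Both energies f and LP vectors μ are represented by the following record.
record Vect (n m L : ℕ) : Set where
  field
    c0 : ℚ
    un : Fin n → Fin (suc L) → ℚ
    pw : Fin m → Fin (suc L) → Fin (suc L) → ℚ    -- components (st , ij), st = edge e
open Vect public

⟨_,_⟩ : ∀ {n m L} → Vect n m L → Vect n m L → ℚ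
⟨ μ , f ⟩ = c0 f * c0 μ
  + (Σ[ _ ] λ s → Σ[ _ ] λ i → un f s i * un μ s i)
  + (Σ[ _ ] λ e → Σ[ _ ] λ i → Σ[ _ ] λ j → pw f e i j * pw μ e i j)

_≐_ : ∀ {n m L} → Vect n m L → Vect n m L → Set
μ ≐ ν = (c0 μ ≡ c0 ν)
  × (∀ s i → un μ s i ≡ un ν s i)
  × (∀ e i j → pw μ e i j ≡ pw ν e i j)

InΛ : ∀ {n m L} → (Fin m → Fin n × Fin n) → Vect n m L → Set
InΛ {n} {m} {L} edge μ =
    (c0 μ ≡ 1ℚ)
  × (∀ s i → 0ℚ ≤ un μ s i)
  × (∀ e i j → 0ℚ ≤ pw μ e i j)
  × (∀ e → (Σ[ _ ] λ i → Σ[ _ ] λ j → pw μ e i j) ≡ 1ℚ)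
  × (∀ e i → (Σ[ _ ] λ j → pw μ e i j) ≡ un μ (proj₁ (edge e)) i)
  × (∀ e j → (Σ[ _ ] λ i → pw μ e i j) ≡ un μ (proj₂ (edge e)) j)

Labeling : ℕ → ℕ → Set
Labeling n L = Fin n → Fin (suc L)

minL maxL : ∀ {L} → Fin (suc L) → Fin (suc L) → Fin (suc L)
minL a b = if ⌊ a ≤? b ⌋ then a else b
maxL a b = if ⌊ a ≤? b ⌋ then b else a

[_≟_]·_ : ∀ {k} → Fin k → Fin k → ℚ → ℚ
[ a ≟ b ]· q = if ⌊ Data.Fin._≟_ a b ⌋ then q else 0ℚ

push : ∀ {n m L} → (Fin (suc L) → Fin (suc L) → Fin (suc L))
     → (Fin m → Fin n × Fin n) → Vect n m L → Labeling n L → Vect n m L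
push op edge μ y = record
  { c0 = c0 μ
  ; un = λ s i → Σ[ _ ] λ i' → [ op i' (y s) ≟ i ]· un μ s i'
  ; pw = λ e i j → Σ[ _ ] λ i' → Σ[ _ ] λ j' →
           [ op i' (y (proj₁ (edge e))) ≟ i ]·
           ([ op j' (y (proj₂ (edge e))) ≟ j ]· pw μ e i' j')
  }

_⊼[_]_ : ∀ {n m L} → Vect n m L → (Fin m → Fin n × Fin n) → Labeling n L → Vect n m L
μ ⊼[ edge ] y = push minL edge μ y

_⊻[_]_ : ∀ {n m L} → Vect n m L → (Fin m → Fin n × Fin n) → Labeling n L → Vect n m L
μ ⊻[ edge ] y = push maxL edge μ y

_≤L_ : ∀ {n L} → Labeling n L → Labeling n L → Set
x ≤L y = ∀ s → Data.Fin._≤_ (x s) (y s)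

StrongLPAutarky : ∀ {n m L} → (Fin m → Fin n × Fin n) → Vect n m L
                → Labeling n L → Labeling n L → Set
StrongLPAutarky edge f xmin xmax =
    (xmin ≤L xmax)
  × (∀ μ → InΛ edge μ → ⟨ (μ ⊻[ edge ] xmin) ⊼[ edge ] xmax , f ⟩ ≤ ⟨ μ , f ⟩)
  × (∀ μ → InΛ edge μ → ¬≐ ((μ ⊻[ edge ] xmin) ⊼[ edge ] xmax) μ
       → ⟨ (μ ⊻[ edge ] xmin) ⊼[ edge ] xmax , f ⟩ < ⟨ μ , f ⟩)
  where
  ¬≐ : _ → _ → Set
  ¬≐ a b = a ≐ b → Data.Empty.⊥

Ltop : ∀ {n L} → Labeling n L
Ltop {L = L} _ = fromℕ L

IsArgmin : ∀ {n m L} → (Fin m → Fin n × Fin n) → Vect n m L → Vect n m L → Set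
IsArgmin edge f μ* = InΛ edge μ* × (∀ μ → InΛ edge μ → ⟨ μ* , f ⟩ ≤ ⟨ μ , f ⟩)

-- Clamping a point of the local polytope into the box [xmin, Ltop] is a pushforward of its
-- marginals along labelwise maps, so it stays in Λ. At a minimiser μ* the strong autarky
-- inequality cannot be strict, hence μ* is fixed by the clamping; but the clamped vector
-- puts no mass on labels below xmin, so neither does μ*.
module Submission where

open import Defs
open import Data.Nat using (ℕ; zero; suc)
open import Data.Fin using (Fin; _<_)
open import Data.Product using (_×_)
open import Data.Rational using (0ℚ)
open import Function.Definitions using (Injective)
open import Relation.Binary.PropositionalEquality using (_≡_)

open import Data.Empty using (⊥-elim)
open import Data.Fin as Fin using (_≤_; _≤?_; fromℕ)
open import Data.Fin.Properties using (≤fromℕ; <⇒≢; suc-injective)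
import Data.Nat.Properties as ℕ
open import Data.Product using (_,_; proj₁; proj₂)
open import Data.Rational using (ℚ; _+_; _≟_) renaming (_≤_ to _≤ℚ_)
import Data.Rational.Properties as ℚ
open import Function using (_∘_; flip; id)
open import Relation.Nullary using (¬_; yes; no)
open import Relation.Nullary.Decidable using (decidable-stable)
open import Relation.Binary.PropositionalEquality using (_≢_; refl; sym; trans; cong; module ≡-Reasoning)
open import Algebra.Properties.CommutativeMonoid.Sum ℚ.+-0-commutativeMonoid
  using (sum; sum-cong-≗; sum-replicate-zero; ∑-comm)

Σ≡sum : ∀ k (g : Fin k → ℚ) → Σ[ k ] g ≡ sum g
Σ≡sum zero    g = refl
Σ≡sum (suc k) g = cong (g Fin.zero +_) (Σ≡sum k (g ∘ Fin.suc))

Σ-cong : ∀ k {g h : Fin k → ℚ} → (∀ i → g i ≡ h i) → Σ[ k ] g ≡ Σ[ k ] h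
Σ-cong k {g} {h} g≗h = trans (Σ≡sum k g) (trans (sum-cong-≗ g≗h) (sym (Σ≡sum k h)))

Σ-zero : ∀ k → Σ[ k ] (λ _ → 0ℚ) ≡ 0ℚ
Σ-zero k = trans (Σ≡sum k _) (sum-replicate-zero k)

Σ-comm : ∀ k l (g : Fin k → Fin l → ℚ) →
  Σ[ k ] (λ a → Σ[ l ] (g a)) ≡ Σ[ l ] (λ b → Σ[ k ] (λ a → g a b))
Σ-comm k l g = begin
  Σ[ k ] (λ a → Σ[ l ] (g a))        ≡⟨ Σ²≡sum² k l g ⟩
  sum (λ a → sum (g a))              ≡⟨ ∑-comm g ⟩
  sum (λ b → sum (λ a → g a b))      ≡⟨ Σ²≡sum² l k (flip g) ⟨
  Σ[ l ] (λ b → Σ[ k ] (λ a → g a b)) ∎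
  where
  open ≡-Reasoning
  Σ²≡sum² : ∀ k l (g : Fin k → Fin l → ℚ) → Σ[ k ] (λ a → Σ[ l ] (g a)) ≡ sum (λ a → sum (g a))
  Σ²≡sum² k l g = trans (Σ-cong k (λ a → Σ≡sum l (g a))) (Σ≡sum k _)

Σ-nonneg : ∀ k (g : Fin k → ℚ) → (∀ i → 0ℚ ≤ℚ g i) → 0ℚ ≤ℚ Σ[ k ] g
Σ-nonneg zero    g 0≤g = ℚ.≤-refl
Σ-nonneg (suc k) g 0≤g = ℚ.≤-trans (ℚ.≤-reflexive (sym (ℚ.+-identityʳ 0ℚ)))
  (ℚ.+-mono-≤ (0≤g Fin.zero) (Σ-nonneg k (g ∘ Fin.suc) (0≤g ∘ Fin.suc)))

[≟]·-cong : ∀ {k l} {a b : Fin k} {c d : Fin l} (q : ℚ) →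
  (a ≡ b → c ≡ d) → (c ≡ d → a ≡ b) → [ a ≟ b ]· q ≡ [ c ≟ d ]· q
[≟]·-cong {a = a} {b} {c} {d} q to from with a Fin.≟ b | c Fin.≟ d
... | yes _   | yes _   = refl
... | no  _   | no  _   = refl
... | yes a≡b | no  c≢d = ⊥-elim (c≢d (to a≡b))
... | no  a≢b | yes c≡d = ⊥-elim (a≢b (from c≡d))

module _ {k : ℕ} where

  [≟]·-≢ : {a b : Fin k} (q : ℚ) → a ≢ b → [ a ≟ b ]· q ≡ 0ℚ
  [≟]·-≢ {a} {b} q a≢b with a Fin.≟ b
  ... | yes a≡b = ⊥-elim (a≢b a≡b)
  ... | no  _   = refl

  [≟]·-nonneg : (a b : Fin k) {q : ℚ} → 0ℚ ≤ℚ q → 0ℚ ≤ℚ [ a ≟ b ]· q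
  [≟]·-nonneg a b 0≤q with a Fin.≟ b
  ... | yes _ = 0≤q
  ... | no  _ = ℚ.≤-refl

  Σ-[≟]· : ∀ l (a b : Fin k) (h : Fin l → ℚ) → Σ[ l ] (λ j → [ a ≟ b ]· h j) ≡ [ a ≟ b ]· Σ[ l ] h
  Σ-[≟]· l a b h with a Fin.≟ b
  ... | yes _ = refl
  ... | no  _ = Σ-zero l

Σ-select : ∀ {k} (a : Fin k) (g : Fin k → ℚ) → Σ[ k ] (λ j → [ a ≟ j ]· g j) ≡ g a
Σ-select {suc k} Fin.zero g = begin
  g Fin.zero + Σ[ k ] (λ j → [ Fin.zero ≟ Fin.suc j ]· g (Fin.suc j))
    ≡⟨ cong (g Fin.zero +_) (Σ-cong k λ j → [≟]·-≢ {a = Fin.zero} {Fin.suc j} (g (Fin.suc j)) λ ()) ⟩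
  g Fin.zero + Σ[ k ] (λ _ → 0ℚ)
    ≡⟨ cong (g Fin.zero +_) (Σ-zero k) ⟩
  g Fin.zero + 0ℚ
    ≡⟨ ℚ.+-identityʳ (g Fin.zero) ⟩
  g Fin.zero ∎
  where open ≡-Reasoning
Σ-select {suc k} (Fin.suc a) g = begin
  0ℚ + Σ[ k ] (λ j → [ Fin.suc a ≟ Fin.suc j ]· g (Fin.suc j))
    ≡⟨ ℚ.+-identityˡ _ ⟩
  Σ[ k ] (λ j → [ Fin.suc a ≟ Fin.suc j ]· g (Fin.suc j))
    ≡⟨ Σ-cong k (λ j → [≟]·-cong (g (Fin.suc j)) suc-injective (cong Fin.suc)) ⟩
  Σ[ k ] (λ j → [ a ≟ j ]· g (Fin.suc j))
    ≡⟨ Σ-select a (g ∘ Fin.suc) ⟩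
  g (Fin.suc a) ∎
  where open ≡-Reasoning

-- The unary and pairwise components of `push op edge μ y` are, definitionally, these
-- pushforwards along the maps i ↦ op i (y s).
module _ {k : ℕ} where

  pushforward₁ : (Fin k → Fin k) → (Fin k → ℚ) → Fin k → ℚ
  pushforward₁ A g i = Σ[ _ ] λ i' → [ A i' ≟ i ]· g i'

  pushforward₂ : (Fin k → Fin k) → (Fin k → Fin k) → (Fin k → Fin k → ℚ) → Fin k → Fin k → ℚ
  pushforward₂ A B w i j = Σ[ _ ] λ i' → Σ[ _ ] λ j' → [ A i' ≟ i ]· ([ B j' ≟ j ]· w i' j')

  pushforward₁-nonneg : ∀ A g → (∀ i → 0ℚ ≤ℚ g i) → ∀ i → 0ℚ ≤ℚ pushforward₁ A g i
  pushforward₁-nonneg A g 0≤g i = Σ-nonneg k _ λ i' → [≟]·-nonneg (A i') i (0≤g i')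

  pushforward₂-nonneg : ∀ A B w → (∀ i j → 0ℚ ≤ℚ w i j) → ∀ i j → 0ℚ ≤ℚ pushforward₂ A B w i j
  pushforward₂-nonneg A B w 0≤w i j = Σ-nonneg k _ λ i' → Σ-nonneg k _ λ j' →
    [≟]·-nonneg (A i') i ([≟]·-nonneg (B j') j (0≤w i' j'))

  Σ-pushforward₁ : ∀ A g → Σ[ k ] (pushforward₁ A g) ≡ Σ[ k ] g
  Σ-pushforward₁ A g = trans (Σ-comm k k _) (Σ-cong k λ i' → Σ-select (A i') (λ _ → g i'))

  pushforward₁-id : ∀ g i → pushforward₁ id g i ≡ g i
  pushforward₁-id g i = trans (Σ-cong k λ i' → [≟]·-cong (g i') sym sym) (Σ-select i g)

  pushforward₁-outside-image : ∀ A g i → (∀ i' → A i' ≢ i) → pushforward₁ A g i ≡ 0ℚ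
  pushforward₁-outside-image A g i i∉A = trans (Σ-cong k λ i' → [≟]·-≢ (g i') (i∉A i')) (Σ-zero k)

  pushforward₂-rows : ∀ A B w i →
    Σ[ k ] (pushforward₂ A B w i) ≡ pushforward₁ A (λ i' → Σ[ k ] (w i')) i
  pushforward₂-rows A B w i = begin
    Σ[ k ] (pushforward₂ A B w i)
      ≡⟨ Σ-comm k k _ ⟩
    Σ[ k ] (λ i' → Σ[ k ] λ j → Σ[ k ] λ j' → [ A i' ≟ i ]· ([ B j' ≟ j ]· w i' j'))
      ≡⟨ Σ-cong k (λ i' → Σ-cong k λ j → Σ-[≟]· k (A i') i _) ⟩
    Σ[ k ] (λ i' → Σ[ k ] λ j → [ A i' ≟ i ]· pushforward₁ B (w i') j)
      ≡⟨ Σ-cong k (λ i' → Σ-[≟]· k (A i') i _) ⟩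
    Σ[ k ] (λ i' → [ A i' ≟ i ]· Σ[ k ] (pushforward₁ B (w i')))
      ≡⟨ Σ-cong k (λ i' → cong ([ A i' ≟ i ]·_) (Σ-pushforward₁ B (w i'))) ⟩
    pushforward₁ A (λ i' → Σ[ k ] (w i')) i ∎
    where open ≡-Reasoning

  pushforward₂-columns : ∀ A B w j →
    Σ[ k ] (λ i → pushforward₂ A B w i j) ≡ pushforward₁ B (λ j' → Σ[ k ] λ i' → w i' j') j
  pushforward₂-columns A B w j = begin
    Σ[ k ] (λ i → pushforward₂ A B w i j)
      ≡⟨ Σ-comm k k _ ⟩
    Σ[ k ] (λ i' → Σ[ k ] λ i → Σ[ k ] λ j' → [ A i' ≟ i ]· ([ B j' ≟ j ]· w i' j'))
      ≡⟨ Σ-cong k (λ i' → Σ-cong k λ i → Σ-[≟]· k (A i') i _) ⟩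
    Σ[ k ] (λ i' → Σ[ k ] λ i → [ A i' ≟ i ]· Σ[ k ] λ j' → [ B j' ≟ j ]· w i' j')
      ≡⟨ Σ-cong k (λ i' → Σ-select (A i') _) ⟩
    Σ[ k ] (λ i' → Σ[ k ] λ j' → [ B j' ≟ j ]· w i' j')
      ≡⟨ Σ-comm k k _ ⟩
    Σ[ k ] (λ j' → Σ[ k ] λ i' → [ B j' ≟ j ]· w i' j')
      ≡⟨ Σ-cong k (λ j' → Σ-[≟]· k (B j') j _) ⟩
    pushforward₁ B (λ j' → Σ[ k ] λ i' → w i' j') j ∎
    where open ≡-Reasoning

  Σ-pushforward₂ : ∀ A B w →
    Σ[ k ] (λ i → Σ[ k ] (pushforward₂ A B w i)) ≡ Σ[ k ] (λ i → Σ[ k ] (w i))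
  Σ-pushforward₂ A B w =
    trans (Σ-cong k (pushforward₂-rows A B w)) (Σ-pushforward₁ A (λ i' → Σ[ k ] (w i')))

module _ {n m L : ℕ} (op : Fin (suc L) → Fin (suc L) → Fin (suc L))
         (edge : Fin m → Fin n × Fin n) (y : Labeling n L) where

  push-InΛ : ∀ μ → InΛ edge μ → InΛ edge (push op edge μ y)
  push-InΛ μ (c0≡1 , 0≤un , 0≤pw , pw-total , pw-rows , pw-columns) =
      c0≡1
    , (λ s → pushforward₁-nonneg (A s) (un μ s) (0≤un s))
    , (λ e → pushforward₂-nonneg (A (s₁ e)) (A (s₂ e)) (pw μ e) (0≤pw e))
    , (λ e → trans (Σ-pushforward₂ (A (s₁ e)) (A (s₂ e)) (pw μ e)) (pw-total e))
    , (λ e i → trans (pushforward₂-rows (A (s₁ e)) (A (s₂ e)) (pw μ e) i)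
                     (Σ-cong _ λ i' → cong ([ A (s₁ e) i' ≟ i ]·_) (pw-rows e i')))
    , (λ e j → trans (pushforward₂-columns (A (s₁ e)) (A (s₂ e)) (pw μ e) j)
                     (Σ-cong _ λ j' → cong ([ A (s₂ e) j' ≟ j ]·_) (pw-columns e j')))
    where
    A : Fin n → Fin (suc L) → Fin (suc L)
    A s i = op i (y s)
    s₁ s₂ : Fin m → Fin n
    s₁ = proj₁ ∘ edge
    s₂ = proj₂ ∘ edge

maxL-≥ʳ : ∀ {L} (a b : Fin (suc L)) → b ≤ maxL a b
maxL-≥ʳ a b with a ≤? b
... | yes _   = ℕ.≤-refl
... | no  a≰b = ℕ.<⇒≤ (ℕ.≰⇒> a≰b)

minL-fromℕ : ∀ {L} (a : Fin (suc L)) → minL a (fromℕ L) ≡ a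
minL-fromℕ {L} a with a ≤? fromℕ L
... | yes _   = refl
... | no  a≰L = ⊥-elim (a≰L (≤fromℕ a))

module _ {n m L : ℕ} (edge : Fin m → Fin n × Fin n) where

  un-⊻-below : ∀ (μ : Vect n m L) x s i → i < x s → un (μ ⊻[ edge ] x) s i ≡ 0ℚ
  un-⊻-below μ x s i i<x = pushforward₁-outside-image _ (un μ s) i
    λ i' max≡i → <⇒≢ (ℕ.<-≤-trans i<x (maxL-≥ʳ i' (x s))) (sym max≡i)

  un-⊼-Ltop : ∀ (μ : Vect n m L) s i → un (μ ⊼[ edge ] Ltop) s i ≡ un μ s i
  un-⊼-Ltop μ s i =
    trans (Σ-cong _ λ i' → cong (λ a → [ a ≟ i ]· un μ s i') (minL-fromℕ i'))
          (pushforward₁-id (un μ s) i)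

  strongLPAutarky-fixes-argmin : ∀ {f μ* : Vect n m L} {xmin xmax} → StrongLPAutarky edge f xmin xmax →
    IsArgmin edge f μ* → ¬ ¬ (((μ* ⊻[ edge ] xmin) ⊼[ edge ] xmax) ≐ μ*)
  strongLPAutarky-fixes-argmin {f} {μ*} {xmin} {xmax} (_ , _ , strict) (μ*∈Λ , μ*-min) moved =
    ℚ.<-irrefl refl (ℚ.<-≤-trans (strict μ* μ*∈Λ moved) (μ*-min _ clamped∈Λ))
    where
    clamped∈Λ : InΛ edge ((μ* ⊻[ edge ] xmin) ⊼[ edge ] xmax)
    clamped∈Λ = push-InΛ minL edge xmax _ (push-InΛ maxL edge xmin μ* μ*∈Λ)

mainTheorem6 : (n m L : ℕ) (edge : Fin m → Fin n × Fin n)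
    → Injective _≡_ _≡_ edge
    → (f : Vect n m L) (xmin : Labeling n L)
    → StrongLPAutarky edge f xmin Ltop
    → (μ* : Vect n m L) → IsArgmin edge f μ*
    → (s : Fin n) (i : Fin (suc L)) → i < xmin s
    → un μ* s i ≡ 0ℚ
mainTheorem6 n m L edge _ f xmin autarky μ* argmin s i i<x =
  decidable-stable (un μ* s i ≟ 0ℚ) λ μ*ₛᵢ≢0 →
    strongLPAutarky-fixes-argmin edge {f} {μ*} autarky argmin λ (_ , un-fixed , _) →
      μ*ₛᵢ≢0 (begin
        un μ* s i                                   ≡⟨ un-fixed s i ⟨
        un ((μ* ⊻[ edge ] xmin) ⊼[ edge ] Ltop) s i ≡⟨ un-⊼-Ltop edge (μ* ⊻[ edge ] xmin) s i ⟩
        un (μ* ⊻[ edge ] xmin) s i                  ≡⟨ un-⊻-below edge μ* xmin s i i<x ⟩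
        0ℚ                                          ∎)
  where open ≡-Reasoning
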